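{- Let $G$ be a non-bipartite graph and $s$ a non-negative integer. Then $$\chi_f\big(G^{\frac{1}{2s+1}}\big)\le \frac{(2s+1)\chi_f(G)}{s\chi_f(G)+1}.$$
   Context: For positive integers $m\ge 2n$, the Kneser graph $\mathrm{KG}(m,n)$ has as vertices the $n$-subsets of $\{1,\dots,m\}$, two being adjacent iff they are disjoint. The fractional chromatic number is $\chi_f(G)=\inf\{\frac mn : \text{there is a homomorphism } G\to \mathrm{KG}(m,n)\}$. For a positive integer $t$, $G^{1/t}$ is the graph obtained from $G$ by replacing each edge by a path with $t$ edges. -}

module Defs where

open import Data.Nat using (ℕ; zero; suc; _+_; _*_; _≤_; _<_)
open import Data.Fin as Fin using (Fin; toℕ)
open import Data.Fin.Subset using (Subset; _∈_; ∣_∣)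
open import Data.Product using (Σ; Σ-syntax; ∃; _×_; _,_)
open import Data.Sum using (_⊎_; inj₁; inj₂)
open import Data.Bool using (Bool)
open import Relation.Binary.PropositionalEquality using (_≡_; _≢_)
open import Relation.Nullary using (¬_)

record FinGraph (N : ℕ) : Set₁ where
  field
    E      : Fin N → Fin N → Set
    E-sym  : ∀ {u v} → E u v → E v u
    E-irr  : ∀ {v} → ¬ E v v

record Graph : Set₁ where
  field
    V : Set
    E : V → V → Set

toGraph : ∀ {N} → FinGraph N → Graph
toGraph {N} G = record { V = Fin N ; E = FinGraph.E G }

NonBipartite : ∀ {N} → FinGraph N → Set
NonBipartite {N} G = ¬ (Σ (Fin N → Bool) λ c → ∀ u v → FinGraph.E G u v → c u ≢ c v)

KVertex : ℕ → ℕ → Set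
KVertex m n = Σ (Subset m) λ S → ∣ S ∣ ≡ n

KAdj : ∀ {m n} → KVertex m n → KVertex m n → Set
KAdj {m} (S , _) (T , _) = ∀ (i : Fin m) → i ∈ S → ¬ (i ∈ T)

-- A homomorphism H → KG(m,n), where KG(m,n) is only considered for
-- positive n and m ≥ 2n, as in the definition.
KneserHom : Graph → ℕ → ℕ → Set
KneserHom H m n =
  (1 ≤ n) × (2 * n ≤ m) ×
  Σ (Graph.V H → KVertex m n) λ f →
    ∀ x y → Graph.E H x y → KAdj (f x) (f y)

-- χ_f(H) ≤ c / d  (d > 0), i.e. inf { a/b : H → KG(a,b) } ≤ c/d:
-- for every ε = 1/k > 0 there is a homomorphism H → KG(a,b) with
-- a/b < c/d + 1/k, i.e.  a·d·k < b·(c·k + d).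
FracChiLe : Graph → ℕ → ℕ → Set
FracChiLe H c d =
  ∀ k → 1 ≤ k → Σ[ a ∈ ℕ ] Σ[ b ∈ ℕ ] (KneserHom H a b × (a * d * k < b * (c * k + d)))

-- Subdivision G^{1/(r+1)}: each edge uv (oriented u < v) replaced by a
-- path u = p₀, p₁, …, p_r, p_{r+1} = v with r new internal vertices
-- (internal vertex p_{i+1} is represented by index i : Fin r).
module _ {N : ℕ} (G : FinGraph N) (r : ℕ) where
  open FinGraph G

  SubEdge : Set
  SubEdge = Σ[ u ∈ Fin N ] Σ[ v ∈ Fin N ] (u Fin.< v) × E u v

  SubV : Set
  SubV = Fin N ⊎ (SubEdge × Fin r)

  data SubArc : SubV → SubV → Set where
    direct : ∀ {u v} (l : u Fin.< v) (e : E u v) → r ≡ 0 →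
             SubArc (inj₁ u) (inj₁ v)
    first  : ∀ {u v} (l : u Fin.< v) (e : E u v) (i : Fin r) → toℕ i ≡ 0 →
             SubArc (inj₁ u) (inj₂ ((u , v , l , e) , i))
    middle : (p : SubEdge) (i j : Fin r) → toℕ j ≡ suc (toℕ i) →
             SubArc (inj₂ (p , i)) (inj₂ (p , j))
    last   : ∀ {u v} (l : u Fin.< v) (e : E u v) (i : Fin r) → suc (toℕ i) ≡ r →
             SubArc (inj₂ ((u , v , l , e) , i)) (inj₁ v)

  Subdivide : Graph
  Subdivide = record { V = SubV ; E = λ x y → SubArc x y ⊎ SubArc y x }

-- Write D = 2s + 1 and take a homomorphism f : G → KG(m, n).  The ground set of
-- KG(mD, sm + n) is m blocks of D points, and in every block we use the low set
-- {0, …, s−1} and its complement, the high set.  An original vertex u gets the high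
-- set in block i if i ∈ f(u) and the low set otherwise.  The subdivision vertices
-- p = 1, …, 2s of an edge uv get, in a block i with i ∈ f(u) ∪ f(v), the high or the
-- low set alternately, so that the block moves from u's set to v's set; in a block
-- with i ∉ f(u) ∪ f(v) they get the sets {ps, …, ps + s − 1} (mod D), which run
-- around the odd cycle of length D inside KG(D, s) and return to the low set after
-- D steps.  Every vertex then gets sm + n points, and adjacent vertices get disjoint
-- sets, block by block.
module Submission where

open import Defs
open import Data.Nat using (ℕ; _+_; _*_)
open import Data.Nat.Base using (suc; _∸_; _≤_; _<_; _<ᵇ_; s≤s; z<s; parity)
open import Data.Nat.Properties
open import Data.Nat.DivMod using (_%_; m<n⇒m%n≡m; [m+n]%n≡m%n; [m+kn]%n≡m%n; m%n%n≡m%n; %-distribˡ-+)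
open import Data.Parity.Base as ℙ using (Parity; 0ℙ; 1ℙ; _⁻¹)
open import Data.Parity.Properties using (suc-homo-⁻¹; ⁻¹-selfInverse; +-homo-+; *-homo-*)
open import Data.Bool.Base using (Bool; true; false; not; T)
open import Data.Bool.Properties using (T-≡)
open import Data.Vec.Base using (Vec; []; _∷_; _++_; concat; zipWith; map)
open import Data.Vec.Properties using (map-id; []=⇒lookup; lookup⇒[]=)
open import Data.Vec.Relation.Binary.Pointwise.Inductive as Pointwise using (Pointwise; []; _∷_; ++⁺)
open import Data.Vec.Relation.Binary.Pointwise.Extensional using (ext; extensional⇒inductive)
open import Data.Fin.Base using (Fin; toℕ)
open import Data.Fin.Subset using (Subset; ∣_∣; ∁)
open import Data.Fin.Subset.Properties using (∣∁p∣≡n∸∣p∣)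
open import Data.Product.Base using (_,_; proj₁; proj₂)
open import Data.Sum.Base using (inj₁; inj₂)
open import Data.Empty using (⊥; ⊥-elim)
open import Function.Base using (_∘_; flip)
open import Function.Bundles using (module Equivalence)
open import Algebra.Properties.CommutativeSemigroup +-commutativeSemigroup using (interchange)
open import Relation.Binary.PropositionalEquality

bit : Bool → ℕ
bit false = 0
bit true  = 1

Apart : Bool → Bool → Set
Apart x y = T x → T y → ⊥

Disjoint : ∀ {k} → Subset k → Subset k → Set
Disjoint = Pointwise Apart

apart-not : ∀ x → Apart x (not x)
apart-not false ()
apart-not true  _ ()

∣∷∣ : ∀ {k} x (xs : Subset k) → ∣ x ∷ xs ∣ ≡ bit x + ∣ xs ∣
∣∷∣ false xs = refl
∣∷∣ true  xs = refl

∣++∣ : ∀ {k l} (xs : Subset k) (ys : Subset l) → ∣ xs ++ ys ∣ ≡ ∣ xs ∣ + ∣ ys ∣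
∣++∣ []           ys = refl
∣++∣ (false ∷ xs) ys = ∣++∣ xs ys
∣++∣ (true  ∷ xs) ys = cong suc (∣++∣ xs ys)

disjoint⇒KAdj : ∀ {m n} {X Y : KVertex m n} → Disjoint (proj₁ X) (proj₁ Y) → KAdj X Y
disjoint⇒KAdj X#Y i i∈X i∈Y =
  Pointwise.lookup X#Y i (Equivalence.from T-≡ ([]=⇒lookup i∈X)) (Equivalence.from T-≡ ([]=⇒lookup i∈Y))

KAdj⇒disjoint : ∀ {m n} {X Y : KVertex m n} → KAdj X Y → Disjoint (proj₁ X) (proj₁ Y)
KAdj⇒disjoint {X = S , _} {Y = S′ , _} X#Y = extensional⇒inductive (ext λ i x y →
  X#Y i (lookup⇒[]= i S (Equivalence.to T-≡ x)) (lookup⇒[]= i S′ (Equivalence.to T-≡ y)))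

zipWith-ignoreʳ : ∀ {A B C : Set} {f : A → B → C} {h : A → C} → (∀ x y → f x y ≡ h x) →
                  ∀ {n} (xs : Vec A n) (ys : Vec B n) → zipWith f xs ys ≡ map h xs
zipWith-ignoreʳ f≗h []       []       = refl
zipWith-ignoreʳ f≗h (x ∷ xs) (y ∷ ys) = cong₂ _∷_ (f≗h x y) (zipWith-ignoreʳ f≗h xs ys)

zipWith-ignoreˡ : ∀ {A B C : Set} {f : A → B → C} {h : B → C} → (∀ x y → f x y ≡ h y) →
                  ∀ {n} (xs : Vec A n) (ys : Vec B n) → zipWith f xs ys ≡ map h ys
zipWith-ignoreˡ f≗h []       []       = refl
zipWith-ignoreˡ f≗h (x ∷ xs) (y ∷ ys) = cong₂ _∷_ (f≗h x y) (zipWith-ignoreˡ f≗h xs ys)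

window : (ℕ → Bool) → ℕ → (N : ℕ) → Subset N
window χ o 0       = []
window χ o (suc N) = χ o ∷ window χ (suc o) N

window-disjoint : ∀ {χ ψ} → (∀ t → Apart (χ t) (ψ t)) → ∀ o N → Disjoint (window χ o N) (window ψ o N)
window-disjoint χ#ψ o 0       = []
window-disjoint χ#ψ o (suc N) = χ#ψ o ∷ window-disjoint χ#ψ (suc o) N

window-cong : ∀ {χ ψ} o N → (∀ t → o ≤ t → t < o + N → χ t ≡ ψ t) → window χ o N ≡ window ψ o N
window-cong o 0       χ≗ψ = refl
window-cong o (suc N) χ≗ψ = cong₂ _∷_
  (χ≗ψ o ≤-refl (m<m+n o z<s))
  (window-cong (suc o) N λ t o<t t<o+1+N → χ≗ψ t (<⇒≤ o<t) (subst (t <_) (sym (+-suc o N)) t<o+1+N))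

window-shift : ∀ χ c o N → window (λ t → χ (c + t)) o N ≡ window χ (c + o) N
window-shift χ c o 0       = refl
window-shift χ c o (suc N) =
  cong (χ (c + o) ∷_) (trans (window-shift χ c (suc o) N) (cong (λ o′ → window χ o′ N) (+-suc c o)))

window-map : ∀ (g : Bool → Bool) χ o N → window (λ t → g (χ t)) o N ≡ map g (window χ o N)
window-map g χ o 0       = refl
window-map g χ o (suc N) = cong (g (χ o) ∷_) (window-map g χ (suc o) N)

∣window∣-false : ∀ o N → ∣ window (λ _ → false) o N ∣ ≡ 0
∣window∣-false o 0       = refl
∣window∣-false o (suc N) = ∣window∣-false (suc o) N

∣window∣-below : ∀ s N → s ≤ N → ∣ window (_<ᵇ s) 0 N ∣ ≡ s
∣window∣-below 0       N       _         = ∣window∣-false 0 N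
∣window∣-below (suc s) (suc N) (s≤s s≤N) =
  cong suc (trans (cong ∣_∣ (sym (window-shift (_<ᵇ suc s) 1 0 N))) (∣window∣-below s N s≤N))

∣window∣-snoc : ∀ χ o N → ∣ window χ o (suc N) ∣ ≡ ∣ window χ o N ∣ + bit (χ (N + o))
∣window∣-snoc χ o 0       = trans (∣∷∣ (χ o) []) (+-identityʳ (bit (χ o)))
∣window∣-snoc χ o (suc N) = begin
  ∣ χ o ∷ window χ (suc o) (suc N) ∣                        ≡⟨ ∣∷∣ (χ o) (window χ (suc o) (suc N)) ⟩
  bit (χ o) + ∣ window χ (suc o) (suc N) ∣                  ≡⟨ cong (bit (χ o) +_) (∣window∣-snoc χ (suc o) N) ⟩
  bit (χ o) + (∣ window χ (suc o) N ∣ + bit (χ (N + suc o))) ≡⟨ +-assoc (bit (χ o)) _ _ ⟨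
  bit (χ o) + ∣ window χ (suc o) N ∣ + bit (χ (N + suc o))   ≡⟨ cong₂ _+_ (∣∷∣ (χ o) (window χ (suc o) N)) (cong (bit ∘ χ) (sym (+-suc N o))) ⟨
  ∣ window χ o (suc N) ∣ + bit (χ (suc N + o))               ∎
  where open ≡-Reasoning

∣window∣-periodic : ∀ χ N → (∀ t → χ (N + t) ≡ χ t) → ∀ o → ∣ window χ o N ∣ ≡ ∣ window χ 0 N ∣
∣window∣-periodic χ N periodic 0       = refl
∣window∣-periodic χ N periodic (suc o) = trans step (∣window∣-periodic χ N periodic o)
  where
  open ≡-Reasoning
  step : ∣ window χ (suc o) N ∣ ≡ ∣ window χ o N ∣
  step = +-cancelˡ-≡ (bit (χ o)) _ _ (begin
    bit (χ o) + ∣ window χ (suc o) N ∣ ≡⟨ ∣∷∣ (χ o) (window χ (suc o) N) ⟨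
    ∣ window χ o (suc N) ∣             ≡⟨ ∣window∣-snoc χ o N ⟩
    ∣ window χ o N ∣ + bit (χ (N + o)) ≡⟨ cong (λ x → ∣ window χ o N ∣ + bit x) (periodic o) ⟩
    ∣ window χ o N ∣ + bit (χ o)       ≡⟨ +-comm _ (bit (χ o)) ⟩
    bit (χ o) + ∣ window χ o N ∣       ∎)

blocks-disjoint : ∀ {k} {g h : Bool → Bool → Subset k} → (∀ {a b} → Apart a b → Disjoint (g a b) (h a b)) →
                  ∀ {m} {A B : Subset m} → Disjoint A B → Disjoint (concat (zipWith g A B)) (concat (zipWith h A B))
blocks-disjoint g#h []          = []
blocks-disjoint g#h (a#b ∷ A#B) = ++⁺ (g#h a#b) (blocks-disjoint g#h A#B)

∣blocks∣ : ∀ {k w} (g : Bool → Bool → Subset k) (h : Bool → Bool → Bool) → (∀ a b → ∣ g a b ∣ ≡ w + bit (h a b)) →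
           ∀ {m} (A B : Subset m) → ∣ concat (zipWith g A B) ∣ ≡ m * w + ∣ zipWith h A B ∣
∣blocks∣                 g h ∣g∣ []      []      = refl
∣blocks∣ {w = w} g h ∣g∣ {suc m} (a ∷ A) (b ∷ B) = begin
  ∣ g a b ++ concat (zipWith g A B) ∣                 ≡⟨ ∣++∣ (g a b) _ ⟩
  ∣ g a b ∣ + ∣ concat (zipWith g A B) ∣               ≡⟨ cong₂ _+_ (∣g∣ a b) (∣blocks∣ g h ∣g∣ A B) ⟩
  w + bit (h a b) + (m * w + ∣ zipWith h A B ∣)       ≡⟨ interchange w (bit (h a b)) (m * w) _ ⟩
  w + m * w + (bit (h a b) + ∣ zipWith h A B ∣)       ≡⟨ cong (w + m * w +_) (∣∷∣ (h a b) (zipWith h A B)) ⟨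
  suc m * w + ∣ h a b ∷ zipWith h A B ∣               ∎
  where open ≡-Reasoning

module Block (s : ℕ) where

  D : ℕ
  D = suc (2 * s)

  end : Bool → ℕ → Bool
  end false t = t <ᵇ s
  end true  t = not (t <ᵇ s)

  -- circ (p * (s + 1)) is {ps, …, ps + s − 1} (mod D), as s + 1 ≡ −s (mod D).
  circ : ℕ → ℕ → Bool
  circ c t = (c + t) % D <ᵇ s

  pick : Parity → Bool → Bool → Bool
  pick 0ℙ a b = a
  pick 1ℙ a b = b

  -- The pair (true, true) never occurs along an edge; it gets the value that makes
  -- block-start and block-end hold without a side condition.
  walk : ℕ → Bool → Bool → ℕ → Bool
  walk p false false = circ (p * suc s)
  walk p a     b     = end (pick (parity p) a b)

  block : ℕ → Bool → Bool → Subset D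
  block p a b = window (walk p a b) 0 D

  endBlock : Bool → Subset D
  endBlock a = window (end a) 0 D

  s≤D : s ≤ D
  s≤D = ≤-trans (m≤m+n s (s + 0)) (n≤1+n (2 * s))

  parity-suc : ∀ p → parity (suc p) ≡ parity p ⁻¹
  parity-suc p = sym (⁻¹-selfInverse (suc-homo-⁻¹ p))

  parity-D : parity D ≡ 1ℙ
  parity-D = trans (+-homo-+ 1 (2 * s)) (cong (1ℙ ℙ.+_) (*-homo-* 2 s))

  end-apart : ∀ x t → Apart (end x t) (end (not x) t)
  end-apart false t = apart-not (t <ᵇ s)
  end-apart true  t = flip (apart-not (t <ᵇ s))

  alternate-apart : ∀ a p t → Apart (end (pick (parity p) a (not a)) t) (end (pick (parity (suc p)) a (not a)) t)
  alternate-apart a p t with parity p | parity-suc p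
  ... | 0ℙ | eq rewrite eq = end-apart a t
  ... | 1ℙ | eq rewrite eq = flip (end-apart a t)

  circ-apart : ∀ c t → Apart (circ c t) (circ (suc s + c) t)
  circ-apart c t x<s y<s = <⇒≱ (<ᵇ⇒< _ s y<s) (begin
    s                         ≤⟨ n≤1+n s ⟩
    suc s                     ≤⟨ m≤m+n (suc s) x ⟩
    suc s + x                 ≡⟨ m<n⇒m%n≡m suc-s+x<D ⟨
    (suc s + x) % D           ≡⟨ %-distribˡ-+ (suc s) x D ⟩
    (suc s % D + x % D) % D   ≡⟨ cong (λ r → (suc s % D + r) % D) (m%n%n≡m%n (c + t) D) ⟩
    (suc s % D + x) % D       ≡⟨ %-distribˡ-+ (suc s) (c + t) D ⟨
    (suc s + (c + t)) % D     ≡⟨ cong (_% D) (+-assoc (suc s) c t) ⟨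
    (suc s + c + t) % D       ∎)
    where
    open ≤-Reasoning
    x = (c + t) % D
    suc-s+x<D : suc s + x < D
    suc-s+x<D = <-≤-trans (+-monoʳ-< (suc s) (<ᵇ⇒< x s x<s))
                          (≤-reflexive (cong (λ r → suc (s + r)) (sym (+-identityʳ s))))

  walk-apart : ∀ {a b} → Apart a b → ∀ p t → Apart (walk p a b t) (walk (suc p) a b t)
  walk-apart {false} {false} _   p t = circ-apart (p * suc s) t
  walk-apart {false} {true}  _   p t = alternate-apart false p t
  walk-apart {true}  {false} _   p t = alternate-apart true p t
  walk-apart {true}  {true}  a#b p t = ⊥-elim (a#b _ _)

  circ-multiple : ∀ k t → t < D → circ (k * D) t ≡ end false t
  circ-multiple k t t<D = cong (_<ᵇ s) (begin
    (k * D + t) % D ≡⟨ cong (_% D) (+-comm (k * D) t) ⟩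
    (t + k * D) % D ≡⟨ [m+kn]%n≡m%n t k D ⟩
    t % D           ≡⟨ m<n⇒m%n≡m t<D ⟩
    t               ∎)
    where open ≡-Reasoning

  block-start : ∀ a b → block 0 a b ≡ endBlock a
  block-start false false = window-cong 0 D λ t _ t<D → circ-multiple 0 t t<D
  block-start false true  = refl
  block-start true  b     = refl

  block-end : ∀ a b → block D a b ≡ endBlock b
  block-end false false = window-cong 0 D λ t _ t<D →
    trans (cong (λ c → circ c t) (*-comm D (suc s))) (circ-multiple (suc s) t t<D)
  block-end false true  = cong (λ π → window (end (pick π false true)) 0 D) parity-D
  block-end true  b     = cong (λ π → window (end (pick π true b)) 0 D) parity-D

  ∣endBlock∣ : ∀ x → ∣ endBlock x ∣ ≡ s + bit x
  ∣endBlock∣ false = trans (∣window∣-below s D s≤D) (sym (+-identityʳ s))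
  ∣endBlock∣ true  = begin
    ∣ window (end true) 0 D ∣           ≡⟨ cong ∣_∣ (window-map not (_<ᵇ s) 0 D) ⟩
    ∣ ∁ (window (_<ᵇ s) 0 D) ∣          ≡⟨ ∣∁p∣≡n∸∣p∣ (window (_<ᵇ s) 0 D) ⟩
    D ∸ ∣ window (_<ᵇ s) 0 D ∣          ≡⟨ cong (D ∸_) (∣window∣-below s D s≤D) ⟩
    D ∸ s                               ≡⟨ cong (_∸ s) (cong (λ r → suc (s + r)) (+-identityʳ s)) ⟩
    suc s + s ∸ s                       ≡⟨ m+n∸n≡m (suc s) s ⟩
    suc s                               ≡⟨ +-comm 1 s ⟩
    s + 1                               ∎
    where open ≡-Reasoning

  ∣circ∣ : ∀ c → ∣ window (circ c) 0 D ∣ ≡ s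
  ∣circ∣ c = begin
    ∣ window (circ c) 0 D ∣        ≡⟨ cong ∣_∣ (window-shift residue c 0 D) ⟩
    ∣ window residue (c + 0) D ∣   ≡⟨ ∣window∣-periodic residue D periodic (c + 0) ⟩
    ∣ window residue 0 D ∣         ≡⟨ cong ∣_∣ (window-cong 0 D λ t _ t<D → circ-multiple 0 t t<D) ⟩
    ∣ window (_<ᵇ s) 0 D ∣         ≡⟨ ∣window∣-below s D s≤D ⟩
    s                              ∎
    where
    open ≡-Reasoning
    residue : ℕ → Bool
    residue u = u % D <ᵇ s
    periodic : ∀ t → residue (D + t) ≡ residue t
    periodic t = cong (_<ᵇ s) (trans (cong (_% D) (+-comm D t)) ([m+n]%n≡m%n t D))

  ∣block∣ : ∀ p a b → ∣ block p a b ∣ ≡ s + bit (pick (parity p) a b)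
  ∣block∣ p false false = trans (∣circ∣ (p * suc s)) (sym (no-extra (parity p)))
    where
    no-extra : ∀ π → s + bit (pick π false false) ≡ s
    no-extra 0ℙ = +-identityʳ s
    no-extra 1ℙ = +-identityʳ s
  ∣block∣ p false true = ∣endBlock∣ (pick (parity p) false true)
  ∣block∣ p true  b    = ∣endBlock∣ (pick (parity p) true b)

module Subdivision {N} (G : FinGraph N) (s m n : ℕ) (f : Fin N → KVertex m n)
                   (f-hom : ∀ u v → FinGraph.E G u v → KAdj (f u) (f v)) where
  open Block s

  along : Fin N → Fin N → ℕ → Subset (m * D)
  along u v p = concat (zipWith (block p) (proj₁ (f u)) (proj₁ (f v)))

  atVertex : Fin N → Subset (m * D)
  atVertex u = concat (map endBlock (proj₁ (f u)))

  along-start : ∀ u v → along u v 0 ≡ atVertex u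
  along-start u v = cong concat (zipWith-ignoreʳ block-start (proj₁ (f u)) (proj₁ (f v)))

  along-end : ∀ u v → along u v D ≡ atVertex v
  along-end u v = cong concat (zipWith-ignoreˡ block-end (proj₁ (f u)) (proj₁ (f v)))

  along-disjoint : ∀ {u v} → FinGraph.E G u v → ∀ p → Disjoint (along u v p) (along u v (suc p))
  along-disjoint {u} {v} e p =
    blocks-disjoint (λ a#b → window-disjoint (walk-apart a#b p) 0 D) (KAdj⇒disjoint {X = f u} {Y = f v} (f-hom u v e))

  ∣along∣ : ∀ u v p → ∣ along u v p ∣ ≡ s * m + n
  ∣along∣ u v p = begin
    ∣ along u v p ∣                                              ≡⟨ ∣blocks∣ (block p) (pick (parity p)) (∣block∣ p) A B ⟩
    m * s + ∣ zipWith (pick (parity p)) A B ∣                    ≡⟨ cong₂ _+_ (*-comm m s) (∣pick∣ (parity p)) ⟩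
    s * m + n                                                    ∎
    where
    open ≡-Reasoning
    A = proj₁ (f u)
    B = proj₁ (f v)
    ∣pick∣ : ∀ π → ∣ zipWith (pick π) A B ∣ ≡ n
    ∣pick∣ 0ℙ = trans (cong ∣_∣ (trans (zipWith-ignoreʳ (λ _ _ → refl) A B) (map-id A))) (proj₂ (f u))
    ∣pick∣ 1ℙ = trans (cong ∣_∣ (trans (zipWith-ignoreˡ (λ _ _ → refl) A B) (map-id B))) (proj₂ (f v))

  image : SubV G (2 * s) → KVertex (m * D) (s * m + n)
  image (inj₁ u)                     = atVertex u , subst (λ X → ∣ X ∣ ≡ s * m + n) (along-start u u) (∣along∣ u u 0)
  image (inj₂ ((u , v , _ , _) , i)) = along u v (suc (toℕ i)) , ∣along∣ u v (suc (toℕ i))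

  image-arc : ∀ {x y} → SubArc G (2 * s) x y → Disjoint (proj₁ (image x)) (proj₁ (image y))
  image-arc (direct {u} {v} _ e 2s≡0) = subst₂ Disjoint
    (along-start u v) (trans (cong (λ r → along u v (suc r)) (sym 2s≡0)) (along-end u v)) (along-disjoint e 0)
  image-arc (first {u} {v} _ e i i≡0) = subst₂ Disjoint
    (along-start u v) (cong (λ r → along u v (suc r)) (sym i≡0)) (along-disjoint e 0)
  image-arc (middle (u , v , _ , e) i j j≡i+1) = subst (Disjoint _)
    (cong (λ r → along u v (suc r)) (sym j≡i+1)) (along-disjoint e (suc (toℕ i)))
  image-arc (last {u} {v} _ e i i+1≡2s) = subst (Disjoint _)
    (trans (cong (λ r → along u v (suc r)) i+1≡2s) (along-end u v)) (along-disjoint e (suc (toℕ i)))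

  image-hom : ∀ x y → Graph.E (Subdivide G (2 * s)) x y → KAdj (image x) (image y)
  image-hom x y (inj₁ x→y) = disjoint⇒KAdj {X = image x} {Y = image y} (image-arc x→y)
  image-hom x y (inj₂ y→x) = disjoint⇒KAdj {X = image x} {Y = image y} (Pointwise.sym flip (image-arc y→x))

kneserHom⇒fracChiLe : ∀ {H a b c d} → KneserHom H a b → a * d ≡ c * b → 1 ≤ d → FracChiLe H c d
kneserHom⇒fracChiLe {a = a} {b} {c} {d} hom@(1≤b , _) ad≡cb 1≤d k _ = a , b , hom , (begin-strict
  a * d * k           ≡⟨ cong (_* k) ad≡cb ⟩
  c * b * k           ≡⟨ cong (_* k) (*-comm c b) ⟩
  b * c * k           ≡⟨ *-assoc b c k ⟩
  b * (c * k)         <⟨ m<m+n (b * (c * k)) (*-mono-≤ 1≤b 1≤d) ⟩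
  b * (c * k) + b * d ≡⟨ *-distribˡ-+ b (c * k) d ⟨
  b * (c * k + d)     ∎)
  where open ≤-Reasoning

theorem3 : ∀ {N} (G : FinGraph N) (s : ℕ) → NonBipartite G →
           ∀ m n → KneserHom (toGraph G) m n →
           FracChiLe (Subdivide G (2 * s)) ((2 * s + 1) * m) (s * m + n)
theorem3 G s _ m n (1≤n , 2n≤m , f , f-hom) =
  kneserHom⇒fracChiLe {c = (2 * s + 1) * m} (1≤d , 2d≤mD , image , image-hom) (cong (_* (s * m + n)) mD≡[2s+1]m) 1≤d
  where
  open Block s using (D)
  open Subdivision G s m n f f-hom
  1≤d : 1 ≤ s * m + n
  1≤d = ≤-trans 1≤n (m≤n+m n (s * m))
  mD≡[2s+1]m : m * D ≡ (2 * s + 1) * m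
  mD≡[2s+1]m = trans (*-comm m D) (cong (_* m) (+-comm 1 (2 * s)))
  2d≤mD : 2 * (s * m + n) ≤ m * D
  2d≤mD = begin
    2 * (s * m + n)     ≡⟨ *-distribˡ-+ 2 (s * m) n ⟩
    2 * (s * m) + 2 * n ≤⟨ +-monoʳ-≤ (2 * (s * m)) 2n≤m ⟩
    2 * (s * m) + m     ≡⟨ +-comm (2 * (s * m)) m ⟩
    m + 2 * (s * m)     ≡⟨ cong (m +_) (trans (*-comm m (2 * s)) (*-assoc 2 s m)) ⟨
    m + m * (2 * s)     ≡⟨ *-suc m (2 * s) ⟨
    m * D               ∎
    where open ≤-Reasoning
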